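{- Let $\mathcal{L}$ be a family of balanced algebraic laws over a signature $\Sigma$, let $\phi$ be an injective endomorphism of $\mathrm{Geo}_{\mathcal{L}}$ and let $\mathrm{Cc}$ be a $\phi$-blueprint for $\mathcal{L}$. Then for all words $w,w'\in\mathcal{W}_{\mathcal{L}}$, if $\mathrm{eval}(w)\sim\mathrm{eval}(w')$ then $\mathtt{ev}(w)=\mathtt{ev}(w')$ in $\mathrm{Geo}_{\mathcal{L}}$.
   Context: $T(\Sigma,V)$ is the set of terms over $\Sigma$ and an infinite set of variables $V$; $x\in V$ is fixed and $T(\Sigma,x)$ is the set of terms whose only variable is $x$. For a law $L=(l,r)$ (balanced: same variables on both sides) and address $\alpha$, $O^{L,+}_\alpha$ is the partial operator replacing the subterm $t/\alpha=l\sigma$ by $r\sigma$, and $O^{L,- }_\alpha$ its inverse. $\mathcal{W}_{\mathcal{L}}$ is the free monoid on letters $O^{L,\pm}_\alpha$ ($L\in\mathcal{L}$); $\mathrm{eval}(w)$ is the partial operator obtained by applying the letters of $w$ left to right; $t\cdot f$ is the image of $t$ under $f$. For partial maps $f,g$ on terms, $f\sim g$ means there is at least one term $t$ with $t\cdot f$ and $t\cdot g$ defined and equal. $G^+_{\mathcal{L}}$ is the monoid generated by all $O^{L,+}_\alpha$. $\mathrm{Geo}_{\mathcal{L}}$ is the group generated by symbols $o^L_\alpha$ subject to all relations $u=v$ with $u,v$ nonempty words in the $o^L_\alpha$ whose evaluations ($o^L_\alpha\mapsto O^{L,+}_\alpha$) coincide in $G^+_{\mathcal{L}}$; $\mathtt{ev}:\mathcal{W}_{\mathcal{L}}\to\mathrm{Geo}_{\mathcal{L}}$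 sends $O^{L,\pm}_\alpha\mapsto(o^L_\alpha)^{\pm1}$. A map $\mathrm{Cc}:T(\Sigma,x)\to\mathrm{Geo}_{\mathcal{L}}$ is a $\phi$-blueprint if $\mathrm{Cc}(t\cdot\mathrm{eval}(w))=\mathrm{Cc}(t)\cdot\phi(\mathtt{ev}(w))$ for all $t\in T(\Sigma,x)$, $w\in\mathcal{W}_{\mathcal{L}}$ with $t\cdot\mathrm{eval}(w)$ defined. -}

module Defs where

open import Data.Nat using (ℕ)
open import Data.Fin using (Fin; toℕ)
open import Data.Vec using (Vec; []; _∷_; lookup; _[_]≔_)
open import Data.List using (List; []; _∷_; _++_; map)
open import Data.Bool using (Bool; true; false)
open import Data.Unit using (⊤)
open import Data.Product using (Σ; _×_; _,_; ∃)
open import Function using (_⇔_)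

record Signature : Set₁ where
  field
    Op    : Set
    arity : Op → ℕ

module Terms (Sig : Signature) where
  open Signature Sig

  data Term (W : Set) : Set where
    var  : W → Term W
    node : (f : Op) → Vec (Term W) (arity f) → Term W

  mutual
    _⟨_⟩ : {W : Set} → Term ℕ → (ℕ → Term W) → Term W
    var v     ⟨ σ ⟩ = σ v
    node f ts ⟨ σ ⟩ = node f (substs ts σ)

    substs : {W : Set} {n : ℕ} → Vec (Term ℕ) n → (ℕ → Term W) → Vec (Term W) n
    substs []       σ = []
    substs (t ∷ ts) σ = (t ⟨ σ ⟩) ∷ substs ts σ

  data Occurs (v : ℕ) : Term ℕ → Set where
    here  : Occurs v (var v)
    there : {f : Op} {ts : Vec (Term ℕ) (arity f)} (i : Fin (arity f)) →
            Occurs v (lookup ts i) → Occurs v (node f ts)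

  Address : Set
  Address = List ℕ

  -- ReplaceAt α t u u' t' : the subterm t/α is defined and equals u,
  -- and t' is t with the subterm at α replaced by u'.
  data ReplaceAt {W : Set} : Address → Term W → Term W → Term W → Term W → Set where
    top  : {u u' : Term W} → ReplaceAt [] u u u' u'
    down : {α : Address} {f : Op} {ts : Vec (Term W) (arity f)} {u u' s' : Term W}
           (i : Fin (arity f)) →
           ReplaceAt α (lookup ts i) u u' s' →
           ReplaceAt (toℕ i ∷ α) (node f ts) u u' (node f (ts [ i ]≔ s'))

Law : Signature → Set
Law Sig = Terms.Term Sig ℕ × Terms.Term Sig ℕ

Balanced : (Sig : Signature) → Law Sig → Set
Balanced Sig (l , r) = ∀ v → Terms.Occurs Sig v l ⇔ Terms.Occurs Sig v r

record LawFamily (Sig : Signature) : Set₁ where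
  field
    Idx      : Set
    law      : Idx → Law Sig
    balanced : ∀ i → Balanced Sig (law i)

module Theory (Sig : Signature) (𝓛 : LawFamily Sig) where
  open Terms Sig public
  open LawFamily 𝓛

  lhs rhs : Idx → Term ℕ
  lhs i with law i
  ... | (l , r) = l
  rhs i with law i
  ... | (l , r) = r

  -- Letters O^{L,±}_α of W_L  (true = +, false = -)
  record Letter : Set where
    constructor O
    field
      L    : Idx
      addr : Address
      sign : Bool

  Word : Set
  Word = List Letter

  -- graph of the partial operator of a letter, acting on T(Σ,W)
  Step : {W : Set} → Letter → Term W → Term W → Set
  Step {W} (O L α true)  t t' =
    Σ (ℕ → Term W) λ σ → ReplaceAt α t (lhs L ⟨ σ ⟩) (rhs L ⟨ σ ⟩) t'
  Step {W} (O L α false) t t' =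
    Σ (ℕ → Term W) λ σ → ReplaceAt α t (rhs L ⟨ σ ⟩) (lhs L ⟨ σ ⟩) t'

  -- graph of eval(w): letters applied left to right
  data Eval {W : Set} : Word → Term W → Term W → Set where
    nil  : {t : Term W} → Eval [] t t
    cons : {a : Letter} {w : Word} {t s t' : Term W} →
           Step a t s → Eval w s t' → Eval (a ∷ w) t t'

  _∼_ : Word → Word → Set
  w ∼ w' = Σ (Term ℕ) λ t → Σ (Term ℕ) λ t' → Eval w t t' × Eval w' t t'

  Gen : Set
  Gen = Idx × Address

  posLetter : Gen → Letter
  posLetter (L , α) = O L α true

  posWord : List Gen → Word
  posWord = map posLetter

  -- equality in G^+_L of evaluations (as partial maps on T(Σ,V))
  SameInG+ : List Gen → List Gen → Set
  SameInG+ u v = ∀ (t t' : Term ℕ) → Eval (posWord u) t t' ⇔ Eval (posWord v) t t'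

  data NonEmpty {A : Set} : List A → Set where
    nonEmpty : {a : A} {as : List A} → NonEmpty (a ∷ as)

  -- Elements of Geo_L are represented by group words (sign, generator);
  -- true = o, false = o⁻¹.
  GWord : Set
  GWord = List (Bool × Gen)

  invG : Bool × Gen → Bool × Gen
  invG (true  , g) = (false , g)
  invG (false , g) = (true , g)

  pos : List Gen → GWord
  pos = map (λ g → (true , g))

  infix 4 _≈_
  data _≈_ : GWord → GWord → Set where
    ≈-refl  : ∀ {a} → a ≈ a
    ≈-sym   : ∀ {a b} → a ≈ b → b ≈ a
    ≈-trans : ∀ {a b c} → a ≈ b → b ≈ c → a ≈ c
    ≈-cong  : ∀ {a b c d} → a ≈ b → c ≈ d → a ++ c ≈ b ++ d
    cancel  : ∀ x → (x ∷ invG x ∷ []) ≈ []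
    rel     : ∀ u v → NonEmpty u → NonEmpty v → SameInG+ u v → pos u ≈ pos v

  evLetter : Letter → Bool × Gen
  evLetter (O L α s) = (s , (L , α))

  ev : Word → GWord
  ev = map evLetter

  record Endo : Set where
    field
      fun  : GWord → GWord
      cong : ∀ {a b} → a ≈ b → fun a ≈ fun b
      hom  : ∀ a b → fun (a ++ b) ≈ fun a ++ fun b

  Injective : Endo → Set
  Injective φ = ∀ {a b} → Endo.fun φ a ≈ Endo.fun φ b → a ≈ b

  -- T(Σ,x): terms whose only variable is x, i.e. terms over the one-point set
  Tx : Set
  Tx = Term ⊤

  IsBlueprint : Endo → (Tx → GWord) → Set
  IsBlueprint φ Cc = ∀ (t : Tx) (w : Word) (t' : Tx) →
    Eval w t t' → Cc t' ≈ Cc t ++ Endo.fun φ (ev w)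

{-# OPTIONS --safe #-}
module Submission where

-- Rewriting commutes with substitution, so collapsing every variable of a
-- witness of eval w ∼ eval w' to x yields terms t, t' of T(Σ,x) with
-- t · eval w = t' = t · eval w'.  The blueprint equation then gives
-- Cc t · φ(ev w) = Cc t' = Cc t · φ(ev w'); cancelling Cc t in the group
-- Geo_L and using injectivity of φ gives ev w = ev w'.

open import Defs
open import Data.Nat using (ℕ)
open import Data.Fin using (Fin; zero; suc)
open import Data.Vec using (Vec; []; _∷_; lookup; _[_]≔_)
open import Data.List using ([]; _∷_; _++_)
open import Data.List.Properties using (++-assoc)
open import Data.Bool using (true; false)
open import Data.Unit using (tt)
open import Data.Product using (_,_)
open import Level using (0ℓ)
open import Relation.Binary.Bundles using (Setoid)
open import Relation.Binary.PropositionalEquality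
  using (_≡_; refl; sym; cong; cong₂; subst; subst₂)
import Relation.Binary.Reasoning.Setoid as SetoidReasoning

module Substitution (Sig : Signature) where
  open Terms Sig

  infixl 5 _⊙_
  _⊙_ : {W : Set} → (ℕ → Term ℕ) → (ℕ → Term W) → ℕ → Term W
  (σ ⊙ τ) v = σ v ⟨ τ ⟩

  mutual
    ⟨⟩-⊙ : {W : Set} (t : Term ℕ) (σ : ℕ → Term ℕ) (τ : ℕ → Term W) →
           t ⟨ σ ⟩ ⟨ τ ⟩ ≡ t ⟨ σ ⊙ τ ⟩
    ⟨⟩-⊙ (var v)     σ τ = refl
    ⟨⟩-⊙ (node f ts) σ τ = cong (node f) (substs-⊙ ts σ τ)

    substs-⊙ : {W : Set} {n : ℕ} (ts : Vec (Term ℕ) n) (σ : ℕ → Term ℕ) (τ : ℕ → Term W) →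
               substs (substs ts σ) τ ≡ substs ts (σ ⊙ τ)
    substs-⊙ []       σ τ = refl
    substs-⊙ (t ∷ ts) σ τ = cong₂ _∷_ (⟨⟩-⊙ t σ τ) (substs-⊙ ts σ τ)

  lookup-substs : {W : Set} {n : ℕ} (ts : Vec (Term ℕ) n) (τ : ℕ → Term W) (i : Fin n) →
                  lookup (substs ts τ) i ≡ lookup ts i ⟨ τ ⟩
  lookup-substs (t ∷ ts) τ zero    = refl
  lookup-substs (t ∷ ts) τ (suc i) = lookup-substs ts τ i

  substs-[]≔ : {W : Set} {n : ℕ} (ts : Vec (Term ℕ) n) (τ : ℕ → Term W) (i : Fin n) (s : Term ℕ) →
               substs (ts [ i ]≔ s) τ ≡ substs ts τ [ i ]≔ (s ⟨ τ ⟩)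
  substs-[]≔ (t ∷ ts) τ zero    s = refl
  substs-[]≔ (t ∷ ts) τ (suc i) s = cong (t ⟨ τ ⟩ ∷_) (substs-[]≔ ts τ i s)

  ReplaceAt-⟨⟩ : {W : Set} (τ : ℕ → Term W) {α : Address} {t u u' t' : Term ℕ} →
                 ReplaceAt α t u u' t' →
                 ReplaceAt α (t ⟨ τ ⟩) (u ⟨ τ ⟩) (u' ⟨ τ ⟩) (t' ⟨ τ ⟩)
  ReplaceAt-⟨⟩ τ top = top
  ReplaceAt-⟨⟩ τ (down {ts = ts} {s' = s'} i r)
    rewrite substs-[]≔ ts τ i s' =
      down i (subst (λ s → ReplaceAt _ s _ _ _) (sym (lookup-substs ts τ i)) (ReplaceAt-⟨⟩ τ r))

module Rewriting (Sig : Signature) (𝓛 : LawFamily Sig) where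
  open Theory Sig 𝓛
  open Substitution Sig

  Step-⟨⟩ : {W : Set} (τ : ℕ → Term W) (a : Letter) {t t' : Term ℕ} →
            Step a t t' → Step a (t ⟨ τ ⟩) (t' ⟨ τ ⟩)
  Step-⟨⟩ τ (O L α true) {t} {t'} (σ , r) = σ ⊙ τ ,
    subst₂ (λ u u' → ReplaceAt α (t ⟨ τ ⟩) u u' (t' ⟨ τ ⟩))
      (⟨⟩-⊙ (lhs L) σ τ) (⟨⟩-⊙ (rhs L) σ τ) (ReplaceAt-⟨⟩ τ r)
  Step-⟨⟩ τ (O L α false) {t} {t'} (σ , r) = σ ⊙ τ ,
    subst₂ (λ u u' → ReplaceAt α (t ⟨ τ ⟩) u u' (t' ⟨ τ ⟩))
      (⟨⟩-⊙ (rhs L) σ τ) (⟨⟩-⊙ (lhs L) σ τ) (ReplaceAt-⟨⟩ τ r)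

  Eval-⟨⟩ : {W : Set} (τ : ℕ → Term W) {w : Word} {t t' : Term ℕ} →
            Eval w t t' → Eval w (t ⟨ τ ⟩) (t' ⟨ τ ⟩)
  Eval-⟨⟩ τ nil                  = nil
  Eval-⟨⟩ τ (cons {a = a} s e) = cons (Step-⟨⟩ τ a s) (Eval-⟨⟩ τ e)

module Geo (Sig : Signature) (𝓛 : LawFamily Sig) where
  open Theory Sig 𝓛

  ≈-setoid : Setoid 0ℓ 0ℓ
  ≈-setoid = record
    { Carrier       = GWord
    ; _≈_           = _≈_
    ; isEquivalence = record { refl = ≈-refl ; sym = ≈-sym ; trans = ≈-trans }
    }

  open SetoidReasoning ≈-setoid

  inverse : GWord → GWord
  inverse []      = []
  inverse (x ∷ c) = inverse c ++ invG x ∷ []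

  cancelˡ : ∀ x → invG x ∷ x ∷ [] ≈ []
  cancelˡ (true  , g) = cancel (false , g)
  cancelˡ (false , g) = cancel (true  , g)

  inverse-inverseˡ : ∀ c → inverse c ++ c ≈ []
  inverse-inverseˡ []      = ≈-refl
  inverse-inverseˡ (x ∷ c) = begin
    (inverse c ++ invG x ∷ []) ++ x ∷ c  ≡⟨ ++-assoc (inverse c) (invG x ∷ []) (x ∷ c) ⟩
    inverse c ++ (invG x ∷ x ∷ []) ++ c  ≈⟨ ≈-cong (≈-refl {inverse c}) (≈-cong (cancelˡ x) (≈-refl {c})) ⟩
    inverse c ++ c                       ≈⟨ inverse-inverseˡ c ⟩
    []                                   ∎

  ++-cancelˡ : ∀ c {a b} → c ++ a ≈ c ++ b → a ≈ b
  ++-cancelˡ c {a} {b} c++a≈c++b = begin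
    a                         ≈⟨ ≈-cong (inverse-inverseˡ c) (≈-refl {a}) ⟨
    (inverse c ++ c) ++ a     ≡⟨ ++-assoc (inverse c) c a ⟩
    inverse c ++ (c ++ a)     ≈⟨ ≈-cong (≈-refl {inverse c}) c++a≈c++b ⟩
    inverse c ++ (c ++ b)     ≡⟨ ++-assoc (inverse c) c b ⟨
    (inverse c ++ c) ++ b     ≈⟨ ≈-cong (inverse-inverseˡ c) (≈-refl {b}) ⟩
    b                         ∎

  blueprint-ev-≈ : (φ : Endo) → Injective φ → (Cc : Tx → GWord) → IsBlueprint φ Cc →
                   {w w' : Word} {t t' : Tx} → Eval w t t' → Eval w' t t' → ev w ≈ ev w'
  blueprint-ev-≈ φ inj Cc blueprint {w} {w'} {t} {t'} e e' =
    inj (++-cancelˡ (Cc t) (≈-trans (≈-sym (blueprint t w t' e)) (blueprint t w' t' e')))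

proposition4p8 : (Sig : Signature) (𝓛 : LawFamily Sig) (φ : Theory.Endo Sig 𝓛) → Theory.Injective Sig 𝓛 φ → (Cc : Theory.Tx Sig 𝓛 → Theory.GWord Sig 𝓛) → Theory.IsBlueprint Sig 𝓛 φ Cc → (w w' : Theory.Word Sig 𝓛) → Theory._∼_ Sig 𝓛 w w' → Theory._≈_ Sig 𝓛 (Theory.ev Sig 𝓛 w) (Theory.ev Sig 𝓛 w')
proposition4p8 Sig 𝓛 φ inj Cc blueprint w w' (t , t' , e , e') =
  blueprint-ev-≈ φ inj Cc blueprint (Eval-⟨⟩ collapse e) (Eval-⟨⟩ collapse e')
  where
    open Theory Sig 𝓛
    open Rewriting Sig 𝓛
    open Geo Sig 𝓛

    collapse : ℕ → Tx
    collapse _ = var tt
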